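{- (Soundness of QBUA$^\Diamond$ triples.) For all resource functions $P,Q$ and commands $C$, if $\vdash_{\mathsf B}^{\Diamond}[P]\,C\,[Q]$ is derivable with the QBUA$^\Diamond$ rules, then $\vDash_{\mathsf B}^{\Diamond}[P]\,C\,[Q]$ holds.
   Context: Commands over integer-valued program variables: $C ::= \mathsf{skip} \mid x:=e \mid \mathsf{assume}(B) \mid \mathsf{tick}(e) \mid C;C \mid C+C \mid C^\star \mid \mathsf{local}\ x\ \mathsf{in}\ C$ ($+$ nondeterministic choice, $C^\star$ nondeterministic iteration). States $\sigma:\mathit{Var}\to\mathbb Z$. Big-step semantics $\langle C,\sigma,p\rangle\Downarrow_l\langle\tau,q\rangle$ (resource $p$ at start, $q$ at end, $l$ minimal level seen): skip/assign/assume (assume requires $B$ true in $\sigma$) leave resource $p$ and have $l=p$; assign updates $x$ to $[\![e]\!]_\sigma$; tick: $\langle\mathsf{tick}(e),\sigma,p\rangle\Downarrow_{\min(p,p-[\![e]\!]_\sigma)}\langle\sigma,p-[\![e]\!]_\sigma\rangle$; seq composes runs with $l=\min(l_1,l_2)$; choice takes a run of either branch; $\langle C^\star,\sigma,p\rangle\Downarrow_p\langle\sigma,p\rangle$ and runs of $C;C^\star$ are runs of $C^\star$; local: from $\langle C,\sigma,p\rangle\Downarrow_l\langle\tau,q\rangle$ infer $\langle\mathsf{local}\ x\ \mathsf{in}\ C,\sigma[x\mapsto v],p\rangle\Downarrow_l\langle\tau[x\mapsto v],q\rangle$. $\Downarrow$ means $\exists l$; $\Downarrow^{\le0}$ means $\exists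 l\le 0$. Resource functions $P:\mathit{State}\to\mathbb Z\cup\{\pm\infty\}$; pointwise $\min,\max,+,-$; $\mathsf{Sup}\,x.P:=\lambda\sigma.\sup_v P(\sigma[x\mapsto v])$; $P\preceq Q$ pointwise $\le$; $[B](\sigma)=+\infty$ if $B$ holds, else $-\infty$; $\mathrm{fv}$, $\mathrm{mod}(C)$ free/modified variables. Semantics: $\vDash_{\mathsf B}^{\Diamond}[P]C[Q]$ iff for all $\sigma$ and $p\le P(\sigma)$ there exist $\tau$, $q\le Q(\tau)$ with $\langle C,\sigma,p\rangle\Downarrow^{\le0}\langle\tau,q\rangle$ (so $P(\sigma)$ under-approximates the high-water mark). QBUA rules ($\vdash_{\mathsf B}$, used as premises): $[P]\mathsf{skip}[P]$; $[P]\,x:=e\,[\mathsf{Sup}\,x'.\min(P[x'/x],[x=e[x'/x]])]$; $[\min(P,[B])]\mathsf{assume}(B)[\min(P,[B])]$; $[P]\mathsf{tick}(e)[P-e]$; seq; choice; loop (from $\forall n<k.[P(n)]C[P(n+1)]$ get $[P(0)]C^\star[P(k)]$); local with $\mathsf{Sup}$; disjunction giving $[\lambda\sigma.\sup_{i}P_i(\sigma)]C[\lambda\sigma.\sup_iQ_i(\sigma)]$; constancy with $\min(\cdot,[B])$ when $\mathrm{fv}(B)\cap\mathrm{mod}(C)=\emptyset$; relax $[P+F]C[Q+F]$ when $\mathrm{fv}(F)\cap\mathrm{mod}(C)=\emptyset$; consequence ($P\preceq P'$, $[P']C[Q']$, $Q'\preceq Q$); substitution ($y$ fresh). QBUA$^\Diamond$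 rules ($\vdash^\Diamond_{\mathsf B}$): if $P\preceq0$: $[P]\mathsf{skip}[P]$, $[P]\,x:=e\,[\mathsf{Sup}\,x'.\min(P[x'/x],[x=e[x'/x]])]$, $[\min(P,[B])]\mathsf{assume}(B)[\min(P,[B])]$, $[P]C^\star[P]$; if $\min(P,P-e)\preceq0$: $[P]\mathsf{tick}(e)[P-e]$; SeqL: from $\vdash^\Diamond_{\mathsf B}[P]C_1[R]$ and $\vdash_{\mathsf B}[R]C_2[Q]$ get $\vdash^\Diamond_{\mathsf B}[P]C_1;C_2[Q]$; SeqR: from $\vdash_{\mathsf B}[P]C_1[R]$ and $\vdash^\Diamond_{\mathsf B}[R]C_2[Q]$ likewise; choice from either branch; Loop: from $\forall n<k.\vdash_{\mathsf B}[P(n)]C[P(n+1)]$ and $\exists m<k.\vdash^\Diamond_{\mathsf B}[P(m)]C[P(m+1)]$ get $\vdash^\Diamond_{\mathsf B}[P(0)]C^\star[P(k)]$; local with $\mathsf{Sup}$; disjunction: from $\forall i\in I.[P_i]C[Q_i]$ get $[\lambda\sigma.\sup_{i\in I}P_i(\sigma)]C[\lambda\sigma.\sup_{i\in I}Q_i(\sigma)]$; constancy with $\min(\cdot,[B])$; relax $[P+F]C[Q+F]$ if $\mathrm{fv}(F)\cap\mathrm{mod}(C)=\emptyset$ and $F\preceq0$; consequence ($P\preceq P'$, $Q'\preceq Q$); substitution ($y\notin\mathrm{fv}(P)\cup\mathrm{fv}(Q)\cup\mathrm{fv}(C)$). -}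

module Defs where

open import Data.Nat as ℕ using (ℕ; zero; suc) renaming (_<_ to _<ℕ_)
open import Data.Integer as ℤ using (ℤ; _⊓_; _≤_) renaming (_+_ to _+ℤ_; _-_ to _-ℤ_; _*_ to _*ℤ_)
open import Data.Integer.Properties using () renaming (_≟_ to _≟ℤ_; _≤?_ to _≤?ℤ_)
open import Data.Bool using (Bool; true; false; if_then_else_; not; _∧_; _∨_)
open import Data.List using (List; []; _∷_; _++_; filter)
open import Data.List.Membership.Propositional using (_∈_; _∉_)
open import Data.Product using (Σ; ∃; _×_; _,_)
open import Relation.Nullary using (¬_; ¬?; does)
open import Relation.Nullary.Decidable using (⌊_⌋)
open import Relation.Binary.PropositionalEquality using (_≡_; _≢_; refl; cong; cong₂)

Var : Set
Var = ℕ

State : Set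
State = Var → ℤ

_[_↦_] : State → Var → ℤ → State
(σ [ x ↦ v ]) z = if does (z ℕ.≟ x) then v else σ z

data Exp : Set where
  num : ℤ → Exp
  var : Var → Exp
  add sub mul : Exp → Exp → Exp

data BExp : Set where
  tt ff : BExp
  leq eq : Exp → Exp → BExp
  bnot : BExp → BExp
  band bor : BExp → BExp → BExp

⟦_⟧ₑ : Exp → State → ℤ
⟦ num n ⟧ₑ σ = n
⟦ var x ⟧ₑ σ = σ x
⟦ add e f ⟧ₑ σ = ⟦ e ⟧ₑ σ +ℤ ⟦ f ⟧ₑ σ
⟦ sub e f ⟧ₑ σ = ⟦ e ⟧ₑ σ -ℤ ⟦ f ⟧ₑ σ
⟦ mul e f ⟧ₑ σ = ⟦ e ⟧ₑ σ *ℤ ⟦ f ⟧ₑ σ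

⟦_⟧ᵦ : BExp → State → Bool
⟦ tt ⟧ᵦ σ = true
⟦ ff ⟧ᵦ σ = false
⟦ leq e f ⟧ᵦ σ = ⌊ ⟦ e ⟧ₑ σ ≤?ℤ ⟦ f ⟧ₑ σ ⌋
⟦ eq e f ⟧ᵦ σ = ⌊ ⟦ e ⟧ₑ σ ≟ℤ ⟦ f ⟧ₑ σ ⌋
⟦ bnot b ⟧ᵦ σ = not (⟦ b ⟧ᵦ σ)
⟦ band b c ⟧ᵦ σ = ⟦ b ⟧ᵦ σ ∧ ⟦ c ⟧ᵦ σ
⟦ bor b c ⟧ᵦ σ = ⟦ b ⟧ᵦ σ ∨ ⟦ c ⟧ᵦ σ

fvE : Exp → List Var
fvE (num n) = []
fvE (var x) = x ∷ []
fvE (add e f) = fvE e ++ fvE f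
fvE (sub e f) = fvE e ++ fvE f
fvE (mul e f) = fvE e ++ fvE f

fvB : BExp → List Var
fvB tt = []
fvB ff = []
fvB (leq e f) = fvE e ++ fvE f
fvB (eq e f) = fvE e ++ fvE f
fvB (bnot b) = fvB b
fvB (band b c) = fvB b ++ fvB c
fvB (bor b c) = fvB b ++ fvB c

renV : Var → Var → Var → Var
renV x y z = if does (z ℕ.≟ x) then y else z

renE : Var → Var → Exp → Exp
renE x y (num n) = num n
renE x y (var z) = var (renV x y z)
renE x y (add e f) = add (renE x y e) (renE x y f)
renE x y (sub e f) = sub (renE x y e) (renE x y f)
renE x y (mul e f) = mul (renE x y e) (renE x y f)

renB : Var → Var → BExp → BExp
renB x y tt = tt
renB x y ff = ff
renB x y (leq e f) = leq (renE x y e) (renE x y f)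
renB x y (eq e f) = eq (renE x y e) (renE x y f)
renB x y (bnot b) = bnot (renB x y b)
renB x y (band b c) = band (renB x y b) (renB x y c)
renB x y (bor b c) = bor (renB x y b) (renB x y c)

data Cmd : Set where
  skip   : Cmd
  assign : Var → Exp → Cmd
  assume : BExp → Cmd
  tick   : Exp → Cmd
  seq    : Cmd → Cmd → Cmd
  choice : Cmd → Cmd → Cmd
  star   : Cmd → Cmd
  local  : Var → Cmd → Cmd

remove : Var → List Var → List Var
remove x = filter (λ z → ¬? (z ℕ.≟ x))

fvC : Cmd → List Var
fvC skip = []
fvC (assign x e) = x ∷ fvE e
fvC (assume b) = fvB b
fvC (tick e) = fvE e
fvC (seq c d) = fvC c ++ fvC d
fvC (choice c d) = fvC c ++ fvC d
fvC (star c) = fvC c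
fvC (local x c) = remove x (fvC c)

modC : Cmd → List Var
modC skip = []
modC (assign x e) = x ∷ []
modC (assume b) = []
modC (tick e) = []
modC (seq c d) = modC c ++ modC d
modC (choice c d) = modC c ++ modC d
modC (star c) = modC c
modC (local x c) = remove x (modC c)

boundC : Cmd → List Var
boundC skip = []
boundC (assign x e) = []
boundC (assume b) = []
boundC (tick e) = []
boundC (seq c d) = boundC c ++ boundC d
boundC (choice c d) = boundC c ++ boundC d
boundC (star c) = boundC c
boundC (local x c) = x ∷ boundC c

renC : Var → Var → Cmd → Cmd
renC x y skip = skip
renC x y (assign z e) = assign (renV x y z) (renE x y e)
renC x y (assume b) = assume (renB x y b)
renC x y (tick e) = tick (renE x y e)
renC x y (seq c d) = seq (renC x y c) (renC x y d)
renC x y (choice c d) = choice (renC x y c) (renC x y d)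
renC x y (star c) = star (renC x y c)
renC x y (local z c) = if does (z ℕ.≟ x) then local z c else local z (renC x y c)

-- Big-step semantics  ⟨ C , σ , p ⟩ ⇓_l ⟨ τ , q ⟩   written  Eval C σ p l τ q

data Eval : Cmd → State → ℤ → ℤ → State → ℤ → Set where
  e-skip   : ∀ {σ p} → Eval skip σ p p σ p
  e-assign : ∀ {x e σ p} → Eval (assign x e) σ p p (σ [ x ↦ ⟦ e ⟧ₑ σ ]) p
  e-assume : ∀ {b σ p} → ⟦ b ⟧ᵦ σ ≡ true → Eval (assume b) σ p p σ p
  e-tick   : ∀ {e σ p} →
             Eval (tick e) σ p (p ⊓ (p -ℤ ⟦ e ⟧ₑ σ)) σ (p -ℤ ⟦ e ⟧ₑ σ)
  e-seq    : ∀ {c d σ ρ τ p r q l₁ l₂} →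
             Eval c σ p l₁ ρ r → Eval d ρ r l₂ τ q → Eval (seq c d) σ p (l₁ ⊓ l₂) τ q
  e-choiceˡ : ∀ {c d σ τ p q l} → Eval c σ p l τ q → Eval (choice c d) σ p l τ q
  e-choiceʳ : ∀ {c d σ τ p q l} → Eval d σ p l τ q → Eval (choice c d) σ p l τ q
  e-star0  : ∀ {c σ p} → Eval (star c) σ p p σ p
  e-starS  : ∀ {c σ τ p q l} → Eval (seq c (star c)) σ p l τ q → Eval (star c) σ p l τ q
  -- from ⟨C,σ,p⟩⇓_l⟨τ,q⟩ infer ⟨local x in C, σ[x↦v], p⟩⇓_l⟨τ[x↦v],q⟩;
  -- here σ' plays the role of σ[x↦v] (σ' agrees with σ off x, v = σ' x)
  e-local  : ∀ {x c σ σ' τ p q l} → Eval c σ p l τ q →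
             (∀ z → z ≢ x → σ' z ≡ σ z) →
             Eval (local x c) σ' p l (τ [ x ↦ σ' x ]) q

data ℤ∞ : Set where
  -∞  : ℤ∞
  fin : ℤ → ℤ∞
  +∞  : ℤ∞

data _≤∞_ : ℤ∞ → ℤ∞ → Set where
  -∞≤     : ∀ {a} → -∞ ≤∞ a
  fin≤fin : ∀ {m n} → m ≤ n → fin m ≤∞ fin n
  ≤+∞     : ∀ {a} → a ≤∞ +∞

min∞ : ℤ∞ → ℤ∞ → ℤ∞
min∞ -∞ b = -∞
min∞ (fin m) -∞ = -∞
min∞ (fin m) (fin n) = fin (m ⊓ n)
min∞ (fin m) +∞ = fin m
min∞ +∞ b = b

-- addition; -∞ is absorbing (so -∞ + +∞ = -∞)
_⊕∞_ : ℤ∞ → ℤ∞ → ℤ∞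
-∞ ⊕∞ b = -∞
fin m ⊕∞ -∞ = -∞
fin m ⊕∞ fin n = fin (m +ℤ n)
fin m ⊕∞ +∞ = +∞
+∞ ⊕∞ -∞ = -∞
+∞ ⊕∞ fin n = +∞
+∞ ⊕∞ +∞ = +∞

_⊖∞_ : ℤ∞ → ℤ → ℤ∞
-∞ ⊖∞ n = -∞
fin m ⊖∞ n = fin (m -ℤ n)
+∞ ⊖∞ n = +∞

-- s is the supremum of the family f (constructive formulation: an upper
-- bound that is approximated from below by the family at every integer)
IsSup : {I : Set} → (I → ℤ∞) → ℤ∞ → Set
IsSup {I} f s = (∀ i → f i ≤∞ s) × (∀ (p : ℤ) → fin p ≤∞ s → ∃ λ i → fin p ≤∞ f i)

-- Resource functions  P : State → ℤ ∪ {±∞}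
-- (functions on states respecting pointwise equality of states, since
--  function extensionality is not available)

_≗ˢ_ : State → State → Set
σ ≗ˢ σ' = ∀ z → σ z ≡ σ' z

record RF : Set where
  field
    fn  : State → ℤ∞
    ext : ∀ {σ σ'} → σ ≗ˢ σ' → fn σ ≡ fn σ'
open RF public

⟦⟧ₑ-ext : ∀ e {σ σ'} → σ ≗ˢ σ' → ⟦ e ⟧ₑ σ ≡ ⟦ e ⟧ₑ σ'
⟦⟧ₑ-ext (num n) h = refl
⟦⟧ₑ-ext (var x) h = h x
⟦⟧ₑ-ext (add e f) h = cong₂ _+ℤ_ (⟦⟧ₑ-ext e h) (⟦⟧ₑ-ext f h)
⟦⟧ₑ-ext (sub e f) h = cong₂ _-ℤ_ (⟦⟧ₑ-ext e h) (⟦⟧ₑ-ext f h)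
⟦⟧ₑ-ext (mul e f) h = cong₂ _*ℤ_ (⟦⟧ₑ-ext e h) (⟦⟧ₑ-ext f h)

⟦⟧ᵦ-ext : ∀ b {σ σ'} → σ ≗ˢ σ' → ⟦ b ⟧ᵦ σ ≡ ⟦ b ⟧ᵦ σ'
⟦⟧ᵦ-ext tt h = refl
⟦⟧ᵦ-ext ff h = refl
⟦⟧ᵦ-ext (leq e f) h = cong₂ (λ a b → ⌊ a ≤?ℤ b ⌋) (⟦⟧ₑ-ext e h) (⟦⟧ₑ-ext f h)
⟦⟧ᵦ-ext (eq e f) h = cong₂ (λ a b → ⌊ a ≟ℤ b ⌋) (⟦⟧ₑ-ext e h) (⟦⟧ₑ-ext f h)
⟦⟧ᵦ-ext (bnot b) h = cong not (⟦⟧ᵦ-ext b h)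
⟦⟧ᵦ-ext (band b c) h = cong₂ _∧_ (⟦⟧ᵦ-ext b h) (⟦⟧ᵦ-ext c h)
⟦⟧ᵦ-ext (bor b c) h = cong₂ _∨_ (⟦⟧ᵦ-ext b h) (⟦⟧ᵦ-ext c h)

upd-ext : ∀ {σ σ'} x {v v'} → σ ≗ˢ σ' → v ≡ v' → (σ [ x ↦ v ]) ≗ˢ (σ' [ x ↦ v' ])
upd-ext x h refl z with does (z ℕ.≟ x)
... | true = refl
... | false = h z

constRF : ℤ∞ → RF
constRF a = record { fn = λ _ → a ; ext = λ _ → refl }

𝟘 : RF
𝟘 = constRF (fin (ℤ.+ 0))

minRF : RF → RF → RF
minRF P Q = record { fn = λ σ → min∞ (fn P σ) (fn Q σ)
                   ; ext = λ h → cong₂ min∞ (ext P h) (ext Q h) }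

_+RF_ : RF → RF → RF
P +RF Q = record { fn = λ σ → fn P σ ⊕∞ fn Q σ
                 ; ext = λ h → cong₂ _⊕∞_ (ext P h) (ext Q h) }

_-RF_ : RF → Exp → RF
P -RF e = record { fn = λ σ → fn P σ ⊖∞ ⟦ e ⟧ₑ σ
                 ; ext = λ h → cong₂ _⊖∞_ (ext P h) (⟦⟧ₑ-ext e h) }

ind : Bool → ℤ∞
ind true = +∞
ind false = -∞

[_] : BExp → RF
[ b ] = record { fn = λ σ → ind (⟦ b ⟧ᵦ σ) ; ext = λ h → cong ind (⟦⟧ᵦ-ext b h) }

substRF : RF → Var → Var → RF
substRF P x y = record { fn = λ σ → fn P (σ [ x ↦ σ y ])
                       ; ext = λ {σ} {σ'} h → ext P (upd-ext x h (h y)) }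

_⪯_ : RF → RF → Set
P ⪯ Q = ∀ σ → fn P σ ≤∞ fn Q σ

IsSupVar : Var → RF → RF → Set
IsSupVar x P R = ∀ σ → IsSup (λ (v : ℤ) → fn P (σ [ x ↦ v ])) (fn R σ)

IsSupFam : {I : Set} → (I → RF) → RF → Set
IsSupFam Ps R = ∀ σ → IsSup (λ i → fn (Ps i) σ) (fn R σ)

-- x ∉ fv(P) for a resource function (semantic: P does not depend on x)
Indep : RF → Var → Set
Indep P x = ∀ σ v → fn P (σ [ x ↦ v ]) ≡ fn P σ

IndepMod : RF → Cmd → Set
IndepMod F c = ∀ z → z ∈ modC c → Indep F z

DisjMod : BExp → Cmd → Set
DisjMod b c = ∀ z → z ∈ modC c → z ∉ fvB b

-- side condition of the substitution rule: y ∉ fv(P) ∪ fv(Q) ∪ fv(C),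
-- plus y not bound in C (no capture when forming C[y/x])
SubstOK : Var → RF → RF → Cmd → Set
SubstOK y P Q c = Indep P y × Indep Q y × y ∉ fvC c × y ∉ boundC c

AssignPost : Var → Exp → Var → RF → RF → Set
AssignPost x e x' P Q =
  (x' ≢ x) × (x' ∉ fvE e) × Indep P x' ×
  IsSupVar x' (minRF (substRF P x x') [ eq (var x) (renE x x' e) ]) Q

data ⊢B : RF → Cmd → RF → Set₁ where
  b-skip   : ∀ {P} → ⊢B P skip P
  b-assign : ∀ {P Q x e x'} → AssignPost x e x' P Q → ⊢B P (assign x e) Q
  b-assume : ∀ {P b} → ⊢B (minRF P [ b ]) (assume b) (minRF P [ b ])
  b-tick   : ∀ {P e} → ⊢B P (tick e) (P -RF e)
  b-seq    : ∀ {P R Q c d} → ⊢B P c R → ⊢B R d Q → ⊢B P (seq c d) Q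
  b-choiceˡ : ∀ {P Q c d} → ⊢B P c Q → ⊢B P (choice c d) Q
  b-choiceʳ : ∀ {P Q c d} → ⊢B P d Q → ⊢B P (choice c d) Q
  b-loop   : ∀ {c} (P : ℕ → RF) (k : ℕ) →
             (∀ n → n <ℕ k → ⊢B (P n) c (P (suc n))) →
             ⊢B (P zero) (star c) (P k)
  b-local  : ∀ {P Q P' Q' x c} → ⊢B P c Q → IsSupVar x P P' → IsSupVar x Q Q' →
             ⊢B P' (local x c) Q'
  b-disj   : ∀ {c P' Q'} {I : Set} (Ps Qs : I → RF) →
             (∀ i → ⊢B (Ps i) c (Qs i)) → IsSupFam Ps P' → IsSupFam Qs Q' →
             ⊢B P' c Q'
  b-const  : ∀ {P Q c b} → ⊢B P c Q → DisjMod b c →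
             ⊢B (minRF P [ b ]) c (minRF Q [ b ])
  b-relax  : ∀ {P Q F c} → ⊢B P c Q → IndepMod F c →
             ⊢B (P +RF F) c (Q +RF F)
  b-conseq : ∀ {P P' Q Q' c} → P ⪯ P' → ⊢B P' c Q' → Q' ⪯ Q → ⊢B P c Q
  b-subst  : ∀ {P Q c x y} → ⊢B P c Q → SubstOK y P Q c →
             ⊢B (substRF P x y) (renC x y c) (substRF Q x y)

data ⊢◇B : RF → Cmd → RF → Set₁ where
  d-skip   : ∀ {P} → P ⪯ 𝟘 → ⊢◇B P skip P
  d-assign : ∀ {P Q x e x'} → P ⪯ 𝟘 → AssignPost x e x' P Q → ⊢◇B P (assign x e) Q
  d-assume : ∀ {P b} → P ⪯ 𝟘 → ⊢◇B (minRF P [ b ]) (assume b) (minRF P [ b ])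
  d-star   : ∀ {P c} → P ⪯ 𝟘 → ⊢◇B P (star c) P
  d-tick   : ∀ {P e} → minRF P (P -RF e) ⪯ 𝟘 → ⊢◇B P (tick e) (P -RF e)
  d-seqL   : ∀ {P R Q c d} → ⊢◇B P c R → ⊢B R d Q → ⊢◇B P (seq c d) Q
  d-seqR   : ∀ {P R Q c d} → ⊢B P c R → ⊢◇B R d Q → ⊢◇B P (seq c d) Q
  d-choiceˡ : ∀ {P Q c d} → ⊢◇B P c Q → ⊢◇B P (choice c d) Q
  d-choiceʳ : ∀ {P Q c d} → ⊢◇B P d Q → ⊢◇B P (choice c d) Q
  d-loop   : ∀ {c} (P : ℕ → RF) (k : ℕ) →
             (∀ n → n <ℕ k → ⊢B (P n) c (P (suc n))) →
             (Σ ℕ λ m → m <ℕ k × ⊢◇B (P m) c (P (suc m))) →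
             ⊢◇B (P zero) (star c) (P k)
  d-local  : ∀ {P Q P' Q' x c} → ⊢◇B P c Q → IsSupVar x P P' → IsSupVar x Q Q' →
             ⊢◇B P' (local x c) Q'
  d-disj   : ∀ {c P' Q'} {I : Set} (Ps Qs : I → RF) →
             (∀ i → ⊢◇B (Ps i) c (Qs i)) → IsSupFam Ps P' → IsSupFam Qs Q' →
             ⊢◇B P' c Q'
  d-const  : ∀ {P Q c b} → ⊢◇B P c Q → DisjMod b c →
             ⊢◇B (minRF P [ b ]) c (minRF Q [ b ])
  d-relax  : ∀ {P Q F c} → ⊢◇B P c Q → IndepMod F c → F ⪯ 𝟘 →
             ⊢◇B (P +RF F) c (Q +RF F)
  d-conseq : ∀ {P P' Q Q' c} → P ⪯ P' → ⊢◇B P' c Q' → Q' ⪯ Q → ⊢◇B P c Q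
  d-subst  : ∀ {P Q c x y} → ⊢◇B P c Q → SubstOK y P Q c →
             ⊢◇B (substRF P x y) (renC x y c) (substRF Q x y)

⊨◇B : RF → Cmd → RF → Set
⊨◇B P c Q =
  ∀ (σ : State) (p : ℤ) → fin p ≤∞ fn P σ →
  Σ State λ τ → Σ ℤ λ q → Σ ℤ λ l →
    (fin q ≤∞ fn Q τ) × (l ≤ ℤ.+ 0) × Eval c σ p l τ q

-- Validity is proved for a family of semantic triples Valid Φ that differ only in a constraint Φ
-- on the level of the witnessing run: ΦB imposes nothing (these are the QBUA triples used as
-- premises) and Φ◇ asks the level to be ≤ 0. Most rules are sound for every Φ. What is specific
-- to ◇ is that the level of a sequential composition, and hence of a loop, is the minimum of the
-- levels of its parts, so one part that reaches 0 suffices; and that framing with F ≤ 0 can only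
-- lower the level. The structural rules rest on three facts about runs: they can be translated
-- in the resource, they leave unmodified variables alone, and they commute with renaming a
-- variable that is fresh for the command.

module Submission where

open import Defs
open import Function using (_∘_)
open import Function.Bundles using (module Equivalence)
open import Data.Nat as ℕ using (ℕ; zero; suc; _<_; z<s; s<s)
open import Data.Integer as ℤ using (ℤ; _⊓_; _≤_; +_) renaming (_+_ to _+ℤ_; _-_ to _-ℤ_; _*_ to _*ℤ_)
import Data.Integer.Properties as ℤ
open import Data.Integer.Tactic.RingSolver using (solve-∀)
open import Data.Bool using (true; false; not; _∧_; _∨_)
open import Data.Bool.Properties using (T-≡)
open import Data.List using ([]; _∷_; _++_)
open import Data.List.Membership.Propositional using (_∈_; _∉_)
open import Data.List.Membership.Propositional.Properties using (∈-++⁺ˡ; ∈-++⁺ʳ; ∈-++⁻; ∈-filter⁺)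
open import Data.List.Relation.Unary.Any using (here; there)
open import Data.List.Relation.Unary.All as All using (All; []; _∷_)
open import Data.List.Relation.Unary.All.Properties using (++⁻ˡ; ++⁻ʳ)
open import Data.Product using (Σ; _×_; _,_; proj₁; proj₂)
open import Data.Sum using ([_,_]′)
open import Data.Unit using (⊤; tt)
open import Relation.Nullary using (¬?; yes; no)
open import Relation.Nullary.Decidable using (dec-true; dec-false; ⌊_⌋; fromWitness)
open import Relation.Binary.PropositionalEquality hiding ([_])

update-self : ∀ (σ : State) x v → (σ [ x ↦ v ]) x ≡ v
update-self σ x v rewrite dec-true (x ℕ.≟ x) refl = refl

update-other : ∀ (σ : State) x v {z} → z ≢ x → (σ [ x ↦ v ]) z ≡ σ z
update-other σ x v {z} z≢x rewrite dec-false (z ℕ.≟ x) z≢x = refl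

update-at-own-value : ∀ (σ : State) x y → (σ [ y ↦ σ x ]) x ≡ σ x
update-at-own-value σ x y with x ℕ.≟ y
... | yes refl = update-self σ x (σ x)
... | no x≢y = update-other σ y (σ x) x≢y

infix 4 _≈_off_
_≈_off_ : State → State → Var → Set
σ ≈ σ' off x = ∀ z → z ≢ x → σ z ≡ σ' z

≈off⇒≗update : ∀ {σ σ' : State} {x v} → σ' ≈ σ off x → σ' x ≡ v → σ' ≗ˢ (σ [ x ↦ v ])
≈off⇒≗update {σ} {σ'} {x} {v} off at z with z ℕ.≟ x
... | yes refl = trans at (sym (update-self σ z v))
... | no z≢x = trans (off z z≢x) (sym (update-other σ x v z≢x))

update-cong-off : ∀ {σ σ' : State} x {u v y} → σ ≈ σ' off y → u ≡ v →
                  (σ [ x ↦ u ]) ≈ (σ' [ x ↦ v ]) off y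
update-cong-off {σ} {σ'} x {u} {v} h u≡v z z≢y with z ℕ.≟ x
... | yes refl = trans (update-self σ z u) (trans u≡v (sym (update-self σ' z v)))
... | no z≢x = trans (update-other σ x u z≢x) (trans (h z z≢y) (sym (update-other σ' x v z≢x)))

renV-self : ∀ x y → renV x y x ≡ y
renV-self x y rewrite dec-true (x ℕ.≟ x) refl = refl

renV-other : ∀ x y {z} → z ≢ x → renV x y z ≡ z
renV-other x y {z} z≢x rewrite dec-false (z ℕ.≟ x) z≢x = refl

[i+k]-j≡[i-j]+k : ∀ i k j → (i +ℤ k) -ℤ j ≡ (i -ℤ j) +ℤ k
[i+k]-j≡[i-j]+k = solve-∀

[i+k]-k≡i : ∀ i k → (i +ℤ k) -ℤ k ≡ i
[i+k]-k≡i = solve-∀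

[i-k]+k≡i : ∀ i k → (i -ℤ k) +ℤ k ≡ i
[i-k]+k≡i = solve-∀

i-[i-k]≡k : ∀ i k → i -ℤ (i -ℤ k) ≡ k
i-[i-k]≡k = solve-∀

+-distribʳ-⊓ : ∀ k i j → (i ⊓ j) +ℤ k ≡ (i +ℤ k) ⊓ (j +ℤ k)
+-distribʳ-⊓ k = ℤ.mono-≤-distrib-⊓ {_+ℤ k} (ℤ.+-monoˡ-≤ k)

≤∞-trans : ∀ {a b c} → a ≤∞ b → b ≤∞ c → a ≤∞ c
≤∞-trans -∞≤ _ = -∞≤
≤∞-trans (fin≤fin m≤n) (fin≤fin n≤k) = fin≤fin (ℤ.≤-trans m≤n n≤k)
≤∞-trans (fin≤fin _) ≤+∞ = ≤+∞
≤∞-trans ≤+∞ ≤+∞ = ≤+∞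

fin≤∞-trans⁻ : ∀ {m a n} → fin m ≤∞ a → a ≤∞ fin n → m ≤ n
fin≤∞-trans⁻ (fin≤fin m≤a) (fin≤fin a≤n) = ℤ.≤-trans m≤a a≤n

≤∞-resp-≡ : ∀ {a b c} → a ≤∞ b → b ≡ c → a ≤∞ c
≤∞-resp-≡ a≤b refl = a≤b

≤∞-min-ind⁻ : ∀ {p} a β → fin p ≤∞ min∞ a (ind β) → β ≡ true × fin p ≤∞ a
≤∞-min-ind⁻ (fin _) true p≤a = refl , p≤a
≤∞-min-ind⁻ +∞ true p≤a = refl , p≤a
≤∞-min-ind⁻ -∞ true ()
≤∞-min-ind⁻ -∞ false ()
≤∞-min-ind⁻ (fin _) false ()
≤∞-min-ind⁻ +∞ false ()

≤∞-min-ind⁺ : ∀ {p} a β → β ≡ true → fin p ≤∞ a → fin p ≤∞ min∞ a (ind β)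
≤∞-min-ind⁺ (fin _) true refl p≤a = p≤a
≤∞-min-ind⁺ +∞ true refl p≤a = p≤a

≤∞-min∞ : ∀ {m n a b} → fin m ≤∞ a → fin n ≤∞ b → fin (m ⊓ n) ≤∞ min∞ a b
≤∞-min∞ (fin≤fin m≤a) (fin≤fin n≤b) = fin≤fin (ℤ.⊓-mono-≤ m≤a n≤b)
≤∞-min∞ {m} {n} (fin≤fin m≤a) ≤+∞ = fin≤fin (ℤ.≤-trans (ℤ.i⊓j≤i m n) m≤a)
≤∞-min∞ {m} {n} ≤+∞ (fin≤fin n≤b) = fin≤fin (ℤ.≤-trans (ℤ.i⊓j≤j m n) n≤b)
≤∞-min∞ ≤+∞ ≤+∞ = ≤+∞

≤∞-⊖∞ : ∀ {m a} v → fin m ≤∞ a → fin (m -ℤ v) ≤∞ (a ⊖∞ v)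
≤∞-⊖∞ v (fin≤fin m≤a) = fin≤fin (ℤ.+-monoˡ-≤ (ℤ.- v) m≤a)
≤∞-⊖∞ v ≤+∞ = ≤+∞

≤∞-⊕∞ : ∀ {m n a b} → fin m ≤∞ a → fin n ≤∞ b → fin (m +ℤ n) ≤∞ (a ⊕∞ b)
≤∞-⊕∞ (fin≤fin m≤a) (fin≤fin n≤b) = fin≤fin (ℤ.+-mono-≤ m≤a n≤b)
≤∞-⊕∞ (fin≤fin _) ≤+∞ = ≤+∞
≤∞-⊕∞ ≤+∞ (fin≤fin _) = ≤+∞
≤∞-⊕∞ ≤+∞ ≤+∞ = ≤+∞

≤∞-⊕∞⁻ : ∀ {p} a b → fin p ≤∞ (a ⊕∞ b) → Σ ℤ λ k → fin (p -ℤ k) ≤∞ a × fin k ≤∞ b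
≤∞-⊕∞⁻ {p} (fin m) (fin n) (fin≤fin p≤m+n) =
  n , fin≤fin (subst (p -ℤ n ≤_) ([i+k]-k≡i m n) (ℤ.+-monoˡ-≤ (ℤ.- n) p≤m+n)) , fin≤fin ℤ.≤-refl
≤∞-⊕∞⁻ {p} (fin m) +∞ _ = p -ℤ m , fin≤fin (ℤ.≤-reflexive (i-[i-k]≡k p m)) , ≤+∞
≤∞-⊕∞⁻ +∞ (fin n) _ = n , ≤+∞ , fin≤fin ℤ.≤-refl
≤∞-⊕∞⁻ +∞ +∞ _ = + 0 , ≤+∞ , ≤+∞
≤∞-⊕∞⁻ -∞ _ ()
≤∞-⊕∞⁻ (fin _) -∞ ()
≤∞-⊕∞⁻ +∞ -∞ ()

∉-++⁻ˡ : ∀ {y : Var} L {M} → y ∉ L ++ M → y ∉ L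
∉-++⁻ˡ L y∉ y∈ = y∉ (∈-++⁺ˡ y∈)

∉-++⁻ʳ : ∀ {y : Var} L {M} → y ∉ L ++ M → y ∉ M
∉-++⁻ʳ L y∉ y∈ = y∉ (∈-++⁺ʳ L y∈)

∉-++⁺-self : ∀ {y : Var} L → y ∉ L → y ∉ L ++ L
∉-++⁺-self L y∉ y∈ = [ y∉ , y∉ ]′ (∈-++⁻ L y∈)

∉-remove⁻ : ∀ {y x L} → y ∉ remove x L → y ≢ x → y ∉ L
∉-remove⁻ {x = x} y∉ y≢x y∈ = y∉ (∈-filter⁺ (λ z → ¬? (z ℕ.≟ x)) y∈ y≢x)

Fresh : Var → Cmd → Set
Fresh y c = y ∉ fvC c × y ∉ boundC c

Fresh-seqˡ : ∀ {y} c d → Fresh y (seq c d) → Fresh y c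
Fresh-seqˡ c d (y∉fv , y∉bound) = ∉-++⁻ˡ (fvC c) y∉fv , ∉-++⁻ˡ (boundC c) y∉bound

Fresh-seqʳ : ∀ {y} c d → Fresh y (seq c d) → Fresh y d
Fresh-seqʳ c d (y∉fv , y∉bound) = ∉-++⁻ʳ (fvC c) y∉fv , ∉-++⁻ʳ (boundC c) y∉bound

Fresh-unfold : ∀ {y} c → Fresh y (star c) → Fresh y (seq c (star c))
Fresh-unfold c (y∉fv , y∉bound) = ∉-++⁺-self (fvC c) y∉fv , ∉-++⁺-self (boundC c) y∉bound

Fresh-local : ∀ {y x} c → Fresh y (local x c) → y ≢ x × Fresh y c
Fresh-local c (y∉fv , y∉bound) = y≢x , ∉-remove⁻ y∉fv y≢x , y∉bound ∘ there
  where y≢x = y∉bound ∘ here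

⟦⟧ₑ-agree : ∀ e {σ σ' : State} → All (λ z → σ z ≡ σ' z) (fvE e) → ⟦ e ⟧ₑ σ ≡ ⟦ e ⟧ₑ σ'
⟦⟧ₑ-agree (num n) _ = refl
⟦⟧ₑ-agree (var x) (σx≡σ'x ∷ []) = σx≡σ'x
⟦⟧ₑ-agree (add e f) h = cong₂ _+ℤ_ (⟦⟧ₑ-agree e (++⁻ˡ (fvE e) h)) (⟦⟧ₑ-agree f (++⁻ʳ (fvE e) h))
⟦⟧ₑ-agree (sub e f) h = cong₂ _-ℤ_ (⟦⟧ₑ-agree e (++⁻ˡ (fvE e) h)) (⟦⟧ₑ-agree f (++⁻ʳ (fvE e) h))
⟦⟧ₑ-agree (mul e f) h = cong₂ _*ℤ_ (⟦⟧ₑ-agree e (++⁻ˡ (fvE e) h)) (⟦⟧ₑ-agree f (++⁻ʳ (fvE e) h))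

⟦⟧ᵦ-agree : ∀ b {σ σ' : State} → All (λ z → σ z ≡ σ' z) (fvB b) → ⟦ b ⟧ᵦ σ ≡ ⟦ b ⟧ᵦ σ'
⟦⟧ᵦ-agree tt _ = refl
⟦⟧ᵦ-agree ff _ = refl
⟦⟧ᵦ-agree (leq e f) h =
  cong₂ (λ m n → ⌊ m ℤ.≤? n ⌋) (⟦⟧ₑ-agree e (++⁻ˡ (fvE e) h)) (⟦⟧ₑ-agree f (++⁻ʳ (fvE e) h))
⟦⟧ᵦ-agree (eq e f) h =
  cong₂ (λ m n → ⌊ m ℤ.≟ n ⌋) (⟦⟧ₑ-agree e (++⁻ˡ (fvE e) h)) (⟦⟧ₑ-agree f (++⁻ʳ (fvE e) h))
⟦⟧ᵦ-agree (bnot b) h = cong not (⟦⟧ᵦ-agree b h)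
⟦⟧ᵦ-agree (band b c) h = cong₂ _∧_ (⟦⟧ᵦ-agree b (++⁻ˡ (fvB b) h)) (⟦⟧ᵦ-agree c (++⁻ʳ (fvB b) h))
⟦⟧ᵦ-agree (bor b c) h = cong₂ _∨_ (⟦⟧ᵦ-agree b (++⁻ˡ (fvB b) h)) (⟦⟧ᵦ-agree c (++⁻ʳ (fvB b) h))

≈off⇒agree : ∀ {σ σ' : State} {y L} → y ∉ L → σ ≈ σ' off y → All (λ z → σ z ≡ σ' z) L
≈off⇒agree y∉L h = All.tabulate λ z∈L → h _ λ { refl → y∉L z∈L }

⟦renE⟧ₑ : ∀ x y e (σ : State) → ⟦ renE x y e ⟧ₑ σ ≡ ⟦ e ⟧ₑ (σ ∘ renV x y)
⟦renE⟧ₑ x y (num n) σ = refl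
⟦renE⟧ₑ x y (var z) σ = refl
⟦renE⟧ₑ x y (add e f) σ = cong₂ _+ℤ_ (⟦renE⟧ₑ x y e σ) (⟦renE⟧ₑ x y f σ)
⟦renE⟧ₑ x y (sub e f) σ = cong₂ _-ℤ_ (⟦renE⟧ₑ x y e σ) (⟦renE⟧ₑ x y f σ)
⟦renE⟧ₑ x y (mul e f) σ = cong₂ _*ℤ_ (⟦renE⟧ₑ x y e σ) (⟦renE⟧ₑ x y f σ)

⟦renB⟧ᵦ : ∀ x y b (σ : State) → ⟦ renB x y b ⟧ᵦ σ ≡ ⟦ b ⟧ᵦ (σ ∘ renV x y)
⟦renB⟧ᵦ x y tt σ = refl
⟦renB⟧ᵦ x y ff σ = refl
⟦renB⟧ᵦ x y (leq e f) σ = cong₂ (λ m n → ⌊ m ℤ.≤? n ⌋) (⟦renE⟧ₑ x y e σ) (⟦renE⟧ₑ x y f σ)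
⟦renB⟧ᵦ x y (eq e f) σ = cong₂ (λ m n → ⌊ m ℤ.≟ n ⌋) (⟦renE⟧ₑ x y e σ) (⟦renE⟧ₑ x y f σ)
⟦renB⟧ᵦ x y (bnot b) σ = cong not (⟦renB⟧ᵦ x y b σ)
⟦renB⟧ᵦ x y (band b c) σ = cong₂ _∧_ (⟦renB⟧ᵦ x y b σ) (⟦renB⟧ᵦ x y c σ)
⟦renB⟧ᵦ x y (bor b c) σ = cong₂ _∨_ (⟦renB⟧ᵦ x y b σ) (⟦renB⟧ᵦ x y c σ)

Eval-≡ : ∀ {c σ τ p p' l l' q q'} → p ≡ p' → l ≡ l' → q ≡ q' →
         Eval c σ p l τ q → Eval c σ p' l' τ q'
Eval-≡ refl refl refl ev = ev

Eval-shift : ∀ {c σ p l τ q} k → Eval c σ p l τ q → Eval c σ (p +ℤ k) (l +ℤ k) τ (q +ℤ k)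
Eval-shift k e-skip = e-skip
Eval-shift k e-assign = e-assign
Eval-shift k (e-assume b≡true) = e-assume b≡true
Eval-shift k (e-tick {e} {σ} {p}) =
  Eval-≡ refl (trans (cong ((p +ℤ k) ⊓_) p+k-v) (sym (+-distribʳ-⊓ k p (p -ℤ ⟦ e ⟧ₑ σ)))) p+k-v e-tick
  where
  p+k-v : (p +ℤ k) -ℤ ⟦ e ⟧ₑ σ ≡ (p -ℤ ⟦ e ⟧ₑ σ) +ℤ k
  p+k-v = [i+k]-j≡[i-j]+k p k (⟦ e ⟧ₑ σ)
Eval-shift k (e-seq {l₁ = l₁} {l₂} ev₁ ev₂) =
  Eval-≡ refl (sym (+-distribʳ-⊓ k l₁ l₂)) refl (e-seq (Eval-shift k ev₁) (Eval-shift k ev₂))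
Eval-shift k (e-choiceˡ ev) = e-choiceˡ (Eval-shift k ev)
Eval-shift k (e-choiceʳ ev) = e-choiceʳ (Eval-shift k ev)
Eval-shift k e-star0 = e-star0
Eval-shift k (e-starS ev) = e-starS (Eval-shift k ev)
Eval-shift k (e-local ev off) = e-local (Eval-shift k ev) off

Eval-unmodified : ∀ {c σ p l τ q} → Eval c σ p l τ q → ∀ z → z ∉ modC c → τ z ≡ σ z
Eval-unmodified e-skip z _ = refl
Eval-unmodified (e-assign {x} {e} {σ}) z z∉ = update-other σ x (⟦ e ⟧ₑ σ) (z∉ ∘ here)
Eval-unmodified (e-assume _) z _ = refl
Eval-unmodified e-tick z _ = refl
Eval-unmodified (e-seq {c} ev₁ ev₂) z z∉ =
  trans (Eval-unmodified ev₂ z (∉-++⁻ʳ (modC c) z∉)) (Eval-unmodified ev₁ z (∉-++⁻ˡ (modC c) z∉))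
Eval-unmodified (e-choiceˡ {c} ev) z z∉ = Eval-unmodified ev z (∉-++⁻ˡ (modC c) z∉)
Eval-unmodified (e-choiceʳ {c} ev) z z∉ = Eval-unmodified ev z (∉-++⁻ʳ (modC c) z∉)
Eval-unmodified e-star0 z _ = refl
Eval-unmodified (e-starS {c} ev) z z∉ = Eval-unmodified ev z (∉-++⁺-self (modC c) z∉)
Eval-unmodified (e-local {x} {σ' = σ'} {τ} ev off) z z∉ with z ℕ.≟ x
... | yes refl = update-self τ z (σ' z)
... | no z≢x = trans (update-other τ x (σ' x) z≢x)
                 (trans (Eval-unmodified ev z (∉-remove⁻ z∉ z≢x)) (sym (off z z≢x)))

Indep-outside : ∀ (F : RF) L {σ τ} → (∀ z → z ∈ L → Indep F z) →
                (∀ z → z ∉ L → τ z ≡ σ z) → fn F τ ≡ fn F σ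
Indep-outside F [] indep agree = ext F λ z → agree z λ ()
Indep-outside F (x ∷ L) {σ} {τ} indep agree =
  trans (Indep-outside F L (λ z z∈L → indep z (there z∈L)) agree')
        (indep x (here refl) σ (τ x))
  where
  agree' : ∀ z → z ∉ L → τ z ≡ (σ [ x ↦ τ x ]) z
  agree' z z∉L with z ℕ.≟ x
  ... | yes refl = sym (update-self σ z (τ z))
  ... | no z≢x = trans (agree z λ { (here z≡x) → z≢x z≡x ; (there z∈L) → z∉L z∈L })
                       (sym (update-other σ x (τ x) z≢x))

Eval-preserves-IndepMod : ∀ F {c σ p l τ q} → IndepMod F c → Eval c σ p l τ q → fn F τ ≡ fn F σ
Eval-preserves-IndepMod F {c} indep ev = Indep-outside F (modC c) indep (Eval-unmodified ev)

Eval-preserves-DisjMod : ∀ b {c σ p l τ q} → DisjMod b c → Eval c σ p l τ q → ⟦ b ⟧ᵦ τ ≡ ⟦ b ⟧ᵦ σ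
Eval-preserves-DisjMod b disj ev =
  ⟦⟧ᵦ-agree b (All.tabulate λ {z} z∈b → Eval-unmodified ev z λ z∈mod → disj z z∈mod z∈b)

Eval-fresh : ∀ {c σ p l τ q} y → Fresh y c → Eval c σ p l τ q →
             ∀ {σ'} → σ' ≈ σ off y →
             Σ State λ τ' → Eval c σ' p l τ' q × τ' ≈ τ off y × τ' y ≡ σ' y
Eval-fresh y _ e-skip {σ'} h = σ' , e-skip , h , refl
Eval-fresh y (y∉fv , _) (e-assign {x} {e} {σ}) {σ'} h =
  σ' [ x ↦ ⟦ e ⟧ₑ σ' ] , e-assign ,
  update-cong-off x h (⟦⟧ₑ-agree e (≈off⇒agree (y∉fv ∘ there) h)) ,
  update-other σ' x _ (y∉fv ∘ here)
Eval-fresh y (y∉fv , _) (e-assume {b} b≡true) {σ'} h =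
  σ' , e-assume (trans (⟦⟧ᵦ-agree b (≈off⇒agree y∉fv h)) b≡true) , h , refl
Eval-fresh y (y∉fv , _) (e-tick {e} {σ} {p}) {σ'} h =
  σ' , Eval-≡ refl (cong (λ v → p ⊓ (p -ℤ v)) e≡) (cong (p -ℤ_) e≡) e-tick , h , refl
  where e≡ = ⟦⟧ₑ-agree e (≈off⇒agree y∉fv h)
Eval-fresh y fresh (e-seq {c} {d} ev₁ ev₂) h
  with Eval-fresh y (Fresh-seqˡ c d fresh) ev₁ h
... | ρ' , ev₁' , hρ , yρ with Eval-fresh y (Fresh-seqʳ c d fresh) ev₂ hρ
... | τ' , ev₂' , hτ , yτ = τ' , e-seq ev₁' ev₂' , hτ , trans yτ yρ
Eval-fresh y fresh (e-choiceˡ {c} {d} ev) h with Eval-fresh y (Fresh-seqˡ c d fresh) ev h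
... | τ' , ev' , hτ = τ' , e-choiceˡ ev' , hτ
Eval-fresh y fresh (e-choiceʳ {c} {d} ev) h with Eval-fresh y (Fresh-seqʳ c d fresh) ev h
... | τ' , ev' , hτ = τ' , e-choiceʳ ev' , hτ
Eval-fresh y _ e-star0 {σ'} h = σ' , e-star0 , h , refl
Eval-fresh y fresh (e-starS {c} ev) h with Eval-fresh y (Fresh-unfold c fresh) ev h
... | τ' , ev' , hτ = τ' , e-starS ev' , hτ
Eval-fresh y fresh (e-local {x} {c} {σ} {σ₀} {τ} ev off) {σ'} h
  with Fresh-local c fresh
... | y≢x , fresh-c with Eval-fresh y fresh-c ev {σ' [ x ↦ σ x ]} body-start
  where
  body-start : (σ' [ x ↦ σ x ]) ≈ σ off y
  body-start z z≢y =
    trans (update-cong-off x h refl z z≢y) (sym (≈off⇒≗update (λ w w≢x → sym (off w w≢x)) refl z))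
... | τ' , ev' , hτ , yτ =
  τ' [ x ↦ σ' x ] , e-local ev' (λ z z≢x → sym (update-other σ' x (σ x) z≢x)) ,
  update-cong-off x hτ (h x (y≢x ∘ sym)) ,
  trans (update-other τ' x _ y≢x) (trans yτ (update-other σ' x _ y≢x))

-- s' is s with the value of x moved to y; s' x is arbitrary.
Moved : Var → Var → State → State → Set
Moved x y s s' = s' y ≡ s x × (∀ z → z ≢ x → z ≢ y → s' z ≡ s z)

Moved-resp-≗ˢ : ∀ {x y s₁ s₂ s'} → s₁ ≗ˢ s₂ → Moved x y s₁ s' → Moved x y s₂ s'
Moved-resp-≗ˢ {x} s₁≗s₂ (moved , rest) =
  trans moved (s₁≗s₂ x) , λ z z≢x z≢y → trans (rest z z≢x z≢y) (s₁≗s₂ z)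

Moved-update-moved : ∀ {x y s s' u v} → Moved x y s s' → u ≡ v → Moved x y (s [ x ↦ u ]) (s' [ y ↦ v ])
Moved-update-moved {x} {y} {s} {s'} {u} {v} (_ , rest) u≡v =
  trans (update-self s' y v) (trans (sym u≡v) (sym (update-self s x u))) ,
  λ z z≢x z≢y → trans (update-other s' y v z≢y) (trans (rest z z≢x z≢y) (sym (update-other s x u z≢x)))

Moved-update-other : ∀ {x y s s' u v z} → Moved x y s s' → z ≢ x → z ≢ y → u ≡ v →
                     Moved x y (s [ z ↦ u ]) (s' [ z ↦ v ])
Moved-update-other {x} {y} {s} {s'} {u} {v} {z} (moved , rest) z≢x z≢y u≡v =
  trans (update-other s' z v (z≢y ∘ sym)) (trans moved (sym (update-other s z u (z≢x ∘ sym)))) ,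
  rest'
  where
  rest' : ∀ w → w ≢ x → w ≢ y → (s' [ z ↦ v ]) w ≡ (s [ z ↦ u ]) w
  rest' w w≢x w≢y with w ℕ.≟ z
  ... | yes refl = trans (update-self s' w v) (trans (sym u≡v) (sym (update-self s w u)))
  ... | no w≢z = trans (update-other s' z v w≢z) (trans (rest w w≢x w≢y) (sym (update-other s z u w≢z)))

Moved⇒agree : ∀ {x y s s' L} → Moved x y s s' → y ∉ L → All (λ z → (s' ∘ renV x y) z ≡ s z) L
Moved⇒agree {x} {y} {s} {s'} (moved , rest) y∉L = All.tabulate λ {z} z∈L → renamed z λ { refl → y∉L z∈L }
  where
  renamed : ∀ z → z ≢ y → s' (renV x y z) ≡ s z
  renamed z z≢y with z ℕ.≟ x
  ... | yes refl = trans (cong s' (renV-self z y)) moved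
  ... | no z≢x = trans (cong s' (renV-other x y z≢x)) (rest z z≢x z≢y)

⟦renE⟧ₑ-Moved : ∀ {x y s s'} e → Moved x y s s' → y ∉ fvE e → ⟦ renE x y e ⟧ₑ s' ≡ ⟦ e ⟧ₑ s
⟦renE⟧ₑ-Moved {x} {y} {s' = s'} e m y∉ = trans (⟦renE⟧ₑ x y e s') (⟦⟧ₑ-agree e (Moved⇒agree m y∉))

⟦renB⟧ᵦ-Moved : ∀ {x y s s'} b → Moved x y s s' → y ∉ fvB b → ⟦ renB x y b ⟧ᵦ s' ≡ ⟦ b ⟧ᵦ s
⟦renB⟧ᵦ-Moved {x} {y} {s' = s'} b m y∉ = trans (⟦renB⟧ᵦ x y b s') (⟦⟧ᵦ-agree b (Moved⇒agree m y∉))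

Eval-rename : ∀ {c s p l t q} x y → Fresh y c → Eval c s p l t q → ∀ {s'} → Moved x y s s' →
              Σ State λ t' → Eval (renC x y c) s' p l t' q × Moved x y t t'
Eval-rename x y _ e-skip {s'} m = s' , e-skip , m
Eval-rename x y (y∉fv , _) (e-assign {z} {e} {s}) {s'} m with z ℕ.≟ x
... | yes refl rewrite renV-self z y =
  s' [ y ↦ ⟦ renE z y e ⟧ₑ s' ] , e-assign , Moved-update-moved m (sym (⟦renE⟧ₑ-Moved e m (y∉fv ∘ there)))
... | no z≢x rewrite renV-other x y z≢x =
  s' [ z ↦ ⟦ renE x y e ⟧ₑ s' ] , e-assign ,
  Moved-update-other m z≢x (y∉fv ∘ here ∘ sym) (sym (⟦renE⟧ₑ-Moved e m (y∉fv ∘ there)))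
Eval-rename x y (y∉fv , _) (e-assume {b} b≡true) {s'} m =
  s' , e-assume (trans (⟦renB⟧ᵦ-Moved b m y∉fv) b≡true) , m
Eval-rename x y (y∉fv , _) (e-tick {e} {s} {p}) {s'} m =
  s' , Eval-≡ refl (cong (λ v → p ⊓ (p -ℤ v)) e≡) (cong (p -ℤ_) e≡) e-tick , m
  where e≡ = ⟦renE⟧ₑ-Moved e m y∉fv
Eval-rename x y fresh (e-seq {c} {d} ev₁ ev₂) m
  with Eval-rename x y (Fresh-seqˡ c d fresh) ev₁ m
... | ρ' , ev₁' , m₁ with Eval-rename x y (Fresh-seqʳ c d fresh) ev₂ m₁
... | t' , ev₂' , m₂ = t' , e-seq ev₁' ev₂' , m₂
Eval-rename x y fresh (e-choiceˡ {c} {d} ev) m with Eval-rename x y (Fresh-seqˡ c d fresh) ev m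
... | t' , ev' , m' = t' , e-choiceˡ ev' , m'
Eval-rename x y fresh (e-choiceʳ {c} {d} ev) m with Eval-rename x y (Fresh-seqʳ c d fresh) ev m
... | t' , ev' , m' = t' , e-choiceʳ ev' , m'
Eval-rename x y _ e-star0 {s'} m = s' , e-star0 , m
Eval-rename x y fresh (e-starS {c} ev) m with Eval-rename x y (Fresh-unfold c fresh) ev m
... | t' , ev' , m' = t' , e-starS ev' , m'
Eval-rename x y fresh (e-local {z} {c} {σ} {s} {τ} ev off) {s'} m@(_ , rest)
  with Fresh-local c fresh | z ℕ.≟ x
... | y≢z , fresh-c | no z≢x rewrite dec-false (z ℕ.≟ x) z≢x
  with Eval-rename x y fresh-c ev
         (Moved-resp-≗ˢ (λ w → sym (≈off⇒≗update (λ w' w'≢z → sym (off w' w'≢z)) refl w))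
                        (Moved-update-other m z≢x (y≢z ∘ sym) refl))
... | t' , ev' , m' =
  t' [ z ↦ s' z ] , e-local ev' (λ w w≢z → sym (update-other s' z (σ z) w≢z)) ,
  Moved-update-other m' z≢x (y≢z ∘ sym) (sym (rest z z≢x (y≢z ∘ sym)))
-- local x c is not renamed, as x is rebound; the body still runs, because y is fresh in it.
Eval-rename x y fresh (e-local {z} {c} {σ} {s} {τ} ev off) {s'} (moved , rest)
  | y≢z , fresh-c | yes refl rewrite dec-true (z ℕ.≟ z) refl
  with Eval-fresh y fresh-c ev {σ [ y ↦ s' y ]} (λ w w≢y → update-other σ y (s' y) w≢y)
... | τ' , ev' , τ'≈τ , τ'y =
  τ' [ z ↦ s' z ] , e-local ev' body-start ,
  trans (update-other τ' z (s' z) y≢z)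
        (trans τ'y (trans (update-self σ y (s' y)) moved)) ,
  λ w w≢z w≢y →
    trans (update-other τ' z (s' z) w≢z) (trans (τ'≈τ w w≢y) (sym (update-other τ z (s z) w≢z)))
  where
  body-start : s' ≈ σ [ y ↦ s' y ] off z
  body-start w w≢z with w ℕ.≟ y
  ... | yes refl = sym (update-self σ w (s' w))
  ... | no w≢y = trans (rest w w≢z w≢y) (trans (off w w≢z) (sym (update-other σ y (s' y) w≢y)))

Outcome : (ℤ → Set) → Cmd → State → ℤ → RF → Set
Outcome Φ c σ p Q =
  Σ State λ τ → Σ ℤ λ q → Σ ℤ λ l → (fin q ≤∞ fn Q τ) × Φ l × Eval c σ p l τ q

record Valid (Φ : ℤ → Set) (P : RF) (c : Cmd) (Q : RF) : Set where
  field run : ∀ σ p → fin p ≤∞ fn P σ → Outcome Φ c σ p Q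
open Valid

ΦB : ℤ → Set
ΦB _ = ⊤

Φ◇ : ℤ → Set
Φ◇ l = l ≤ + 0

Admits : (ℤ → Set) → RF → Set
Admits Φ P = ∀ σ {p} → fin p ≤∞ fn P σ → Φ p

Combines : (ℤ → Set) → (ℤ → Set) → (ℤ → Set) → Set
Combines Φ₁ Φ₂ Φ = ∀ l₁ l₂ → Φ₁ l₁ → Φ₂ l₂ → Φ (l₁ ⊓ l₂)

Admits◇ : ∀ P → P ⪯ 𝟘 → Admits Φ◇ P
Admits◇ P P⪯𝟘 σ p≤P = fin≤∞-trans⁻ p≤P (P⪯𝟘 σ)

ΦB-combines : Combines ΦB ΦB ΦB
ΦB-combines _ _ _ _ = tt

Φ◇-combinesˡ : Combines Φ◇ ΦB Φ◇
Φ◇-combinesˡ _ l₂ l₁≤0 _ = ℤ.i≤j⇒i⊓k≤j l₂ l₁≤0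

Φ◇-combinesʳ : Combines ΦB Φ◇ Φ◇
Φ◇-combinesʳ l₁ _ _ l₂≤0 = ℤ.i≤j⇒k⊓i≤j l₁ l₂≤0

Valid-map : ∀ {Φ P Q c c'} → (∀ {σ p l τ q} → Eval c σ p l τ q → Eval c' σ p l τ q) →
            Valid Φ P c Q → Valid Φ P c' Q
Valid-map f v .run σ p p≤P with v .run σ p p≤P
... | τ , q , l , q≤Q , φ , ev = τ , q , l , q≤Q , φ , f ev

conseq-s : ∀ {Φ P P' Q Q' c} → P ⪯ P' → Valid Φ P' c Q' → Q' ⪯ Q → Valid Φ P c Q
conseq-s P⪯P' v Q'⪯Q .run σ p p≤P with v .run σ p (≤∞-trans p≤P (P⪯P' σ))
... | τ , q , l , q≤Q' , φ , ev = τ , q , l , ≤∞-trans q≤Q' (Q'⪯Q τ) , φ , ev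

seq-s : ∀ {Φ₁ Φ₂ Φ P R Q c d} → Combines Φ₁ Φ₂ Φ → Valid Φ₁ P c R → Valid Φ₂ R d Q →
        Valid Φ P (seq c d) Q
seq-s comb v w .run σ p p≤P with v .run σ p p≤P
... | ρ , r , l₁ , r≤R , φ₁ , ev₁ with w .run ρ r r≤R
... | τ , q , l₂ , q≤Q , φ₂ , ev₂ = τ , q , l₁ ⊓ l₂ , q≤Q , comb l₁ l₂ φ₁ φ₂ , e-seq ev₁ ev₂

star-step-s : ∀ {Φ₁ Φ₂ Φ P R Q c} → Combines Φ₁ Φ₂ Φ → Valid Φ₁ P c R → Valid Φ₂ R (star c) Q →
              Valid Φ P (star c) Q
star-step-s comb v w = Valid-map e-starS (seq-s comb v w)

skip-s : ∀ {Φ P} → Admits Φ P → Valid Φ P skip P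
skip-s adm .run σ p p≤P = σ , p , p , p≤P , adm σ p≤P , e-skip

star0-s : ∀ {Φ P c} → Admits Φ P → Valid Φ P (star c) P
star0-s adm .run σ p p≤P = σ , p , p , p≤P , adm σ p≤P , e-star0

iterate-s : ∀ {c} (P : ℕ → RF) k → (∀ n → n < k → Valid ΦB (P n) c (P (suc n))) →
            Valid ΦB (P zero) (star c) (P k)
iterate-s P zero _ = star0-s λ _ _ → tt
iterate-s P (suc k) steps =
  star-step-s ΦB-combines (steps zero z<s) (iterate-s (P ∘ suc) k λ n n<k → steps (suc n) (s<s n<k))

loop◇-s : ∀ {c} (P : ℕ → RF) k m → m < k → (∀ n → n < k → Valid ΦB (P n) c (P (suc n))) →
          Valid Φ◇ (P m) c (P (suc m)) → Valid Φ◇ (P zero) (star c) (P k)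
loop◇-s P (suc k) zero _ steps dip =
  star-step-s Φ◇-combinesˡ dip (iterate-s (P ∘ suc) k λ n n<k → steps (suc n) (s<s n<k))
loop◇-s P (suc k) (suc m) (s<s m<k) steps dip =
  star-step-s Φ◇-combinesʳ (steps zero z<s)
    (loop◇-s (P ∘ suc) k m m<k (λ n n<k → steps (suc n) (s<s n<k)) dip)

assume-s : ∀ {Φ P b} → Admits Φ P → Valid Φ (minRF P [ b ]) (assume b) (minRF P [ b ])
assume-s {P = P} {b} adm .run σ p p≤ with ≤∞-min-ind⁻ (fn P σ) (⟦ b ⟧ᵦ σ) p≤
... | b≡true , p≤P = σ , p , p , p≤ , adm σ p≤P , e-assume b≡true

tick-s : ∀ {Φ P e} → (∀ σ {p} → fin p ≤∞ fn P σ → Φ (p ⊓ (p -ℤ ⟦ e ⟧ₑ σ))) →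
         Valid Φ P (tick e) (P -RF e)
tick-s {e = e} adm .run σ p p≤P =
  σ , p -ℤ ⟦ e ⟧ₑ σ , _ , ≤∞-⊖∞ (⟦ e ⟧ₑ σ) p≤P , adm σ p≤P , e-tick

assign-s : ∀ {Φ P Q x e x'} → Admits Φ P → AssignPost x e x' P Q → Valid Φ P (assign x e) Q
assign-s {P = P} {x = x} {e} {x'} adm (x'≢x , x'∉e , P-indep-x' , sup) .run σ p p≤P =
  τ , p , p , ≤∞-trans (≤∞-min-ind⁺ _ _ guard p≤P[x'/x]) (proj₁ (sup τ) (σ x)) , adm σ p≤P , e-assign
  where
  -- Sup x' is attained at the value x had before the assignment.
  τ s : State
  τ = σ [ x ↦ ⟦ e ⟧ₑ σ ]
  s = τ [ x' ↦ σ x ]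
  x'-moved : Moved x x' σ s
  x'-moved = update-self τ x' (σ x) ,
             λ z z≢x z≢x' → trans (update-other τ x' (σ x) z≢x') (update-other σ x _ z≢x)
  restore : s [ x ↦ s x' ] ≈ σ off x'
  restore z z≢x' with z ℕ.≟ x
  ... | yes refl = trans (update-self s z (s x')) (update-self τ x' (σ z))
  ... | no z≢x = trans (update-other s x (s x') z≢x) (proj₂ x'-moved z z≢x z≢x')
  p≤P[x'/x] : fin p ≤∞ fn P (s [ x ↦ s x' ])
  p≤P[x'/x] = ≤∞-resp-≡ p≤P (sym (trans (ext P (≈off⇒≗update restore
                (trans (update-other s x (s x') x'≢x) (proj₁ x'-moved)))) (P-indep-x' σ (σ x))))
  guard : ⟦ eq (var x) (renE x x' e) ⟧ᵦ s ≡ true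
  guard = Equivalence.to T-≡ (fromWitness (trans (update-other τ x' (σ x) (x'≢x ∘ sym))
                   (trans (update-self σ x (⟦ e ⟧ₑ σ)) (sym (⟦renE⟧ₑ-Moved e x'-moved x'∉e)))))

local-s : ∀ {Φ P Q P' Q' x c} → IsSupVar x P P' → IsSupVar x Q Q' → Valid Φ P c Q →
          Valid Φ P' (local x c) Q'
local-s {Q = Q} {x = x} supP supQ v .run σ p p≤P' with proj₂ (supP σ) p p≤P'
... | v₀ , p≤P with v .run (σ [ x ↦ v₀ ]) p p≤P
... | τ , q , l , q≤Q , φ , ev =
  τ [ x ↦ σ x ] , q , l ,
  ≤∞-trans (≤∞-resp-≡ q≤Q (ext Q τ≗)) (proj₁ (supQ (τ [ x ↦ σ x ])) (τ x)) , φ ,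
  e-local ev (λ z z≢x → sym (update-other σ x v₀ z≢x))
  where
  τ≗ : τ ≗ˢ ((τ [ x ↦ σ x ]) [ x ↦ τ x ])
  τ≗ = ≈off⇒≗update (λ z z≢x → sym (update-other τ x (σ x) z≢x)) refl

disj-s : ∀ {Φ c P' Q'} {I : Set} (Ps Qs : I → RF) → IsSupFam Ps P' → IsSupFam Qs Q' →
         (∀ i → Valid Φ (Ps i) c (Qs i)) → Valid Φ P' c Q'
disj-s Ps Qs supP supQ vs .run σ p p≤P' with proj₂ (supP σ) p p≤P'
... | i , p≤Pᵢ with vs i .run σ p p≤Pᵢ
... | τ , q , l , q≤Qᵢ , φ , ev = τ , q , l , ≤∞-trans q≤Qᵢ (proj₁ (supQ τ) i) , φ , ev

const-s : ∀ {Φ P Q c} b → DisjMod b c → Valid Φ P c Q → Valid Φ (minRF P [ b ]) c (minRF Q [ b ])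
const-s {P = P} {Q} b disj v .run σ p p≤ with ≤∞-min-ind⁻ (fn P σ) (⟦ b ⟧ᵦ σ) p≤
... | b≡true , p≤P with v .run σ p p≤P
... | τ , q , l , q≤Q , φ , ev =
  τ , q , l ,
  ≤∞-min-ind⁺ (fn Q τ) (⟦ b ⟧ᵦ τ) (trans (Eval-preserves-DisjMod b disj ev) b≡true) q≤Q , φ , ev

-- Split p ≤ P + F as (p - k) ≤ P and k ≤ F, run from p - k and translate the run by k.
relax-s : ∀ {Φ P Q F c} → (∀ σ {k l} → fin k ≤∞ fn F σ → Φ l → Φ (l +ℤ k)) → IndepMod F c →
          Valid Φ P c Q → Valid Φ (P +RF F) c (Q +RF F)
relax-s {P = P} {Q} {F} shiftΦ indep v .run σ p p≤ with ≤∞-⊕∞⁻ (fn P σ) (fn F σ) p≤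
... | k , p-k≤P , k≤F with v .run σ (p -ℤ k) p-k≤P
... | τ , q , l , q≤Q , φ , ev =
  τ , q +ℤ k , l +ℤ k ,
  ≤∞-⊕∞ q≤Q (≤∞-resp-≡ k≤F (sym (Eval-preserves-IndepMod F indep ev))) , shiftΦ σ k≤F φ ,
  Eval-≡ ([i-k]+k≡i p k) refl refl (Eval-shift k ev)

-- The run of c from σ [ x ↦ σ y ] is renamed into a run of c[y/x] from σ.
subst-s : ∀ {Φ P Q c x y} → SubstOK y P Q c → Valid Φ P c Q →
          Valid Φ (substRF P x y) (renC x y c) (substRF Q x y)
subst-s {Q = Q} {x = x} {y} (_ , Q-indep-y , fresh) v .run σ p p≤ with v .run (σ [ x ↦ σ y ]) p p≤
... | t , q , l , q≤Q , φ , ev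
  with Eval-rename x y fresh ev {σ}
         (sym (update-self σ x (σ y)) , λ z z≢x _ → sym (update-other σ x (σ y) z≢x))
... | t' , ev' , (moved , rest) =
  t' , q , l , ≤∞-resp-≡ q≤Q (trans (sym (Q-indep-y t (t x))) (ext Q t≗)) , φ , ev'
  where
  t≈ : t [ y ↦ t x ] ≈ t' off x
  t≈ z z≢x with z ℕ.≟ y
  ... | yes refl = trans (update-self t z (t x)) (sym moved)
  ... | no z≢y = trans (update-other t y (t x) z≢y) (sym (rest z z≢x z≢y))
  t≗ : (t [ y ↦ t x ]) ≗ˢ (t' [ x ↦ t' y ])
  t≗ = ≈off⇒≗update t≈ (trans (update-at-own-value t x y) (sym moved))

soundB : ∀ {P Q c} → ⊢B P c Q → Valid ΦB P c Q
soundB b-skip = skip-s λ _ _ → tt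
soundB (b-assign post) = assign-s (λ _ _ → tt) post
soundB b-assume = assume-s λ _ _ → tt
soundB b-tick = tick-s λ _ _ → tt
soundB (b-seq ⊢c ⊢d) = seq-s ΦB-combines (soundB ⊢c) (soundB ⊢d)
soundB (b-choiceˡ ⊢c) = Valid-map e-choiceˡ (soundB ⊢c)
soundB (b-choiceʳ ⊢d) = Valid-map e-choiceʳ (soundB ⊢d)
soundB (b-loop P k steps) = iterate-s P k λ n n<k → soundB (steps n n<k)
soundB (b-local ⊢c supP supQ) = local-s supP supQ (soundB ⊢c)
soundB (b-disj Ps Qs ⊢cs supP supQ) = disj-s Ps Qs supP supQ λ i → soundB (⊢cs i)
soundB (b-const {b = b} ⊢c disj) = const-s b disj (soundB ⊢c)
soundB (b-relax ⊢c indep) = relax-s (λ _ _ _ → tt) indep (soundB ⊢c)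
soundB (b-conseq P⪯P' ⊢c Q'⪯Q) = conseq-s P⪯P' (soundB ⊢c) Q'⪯Q
soundB (b-subst ⊢c ok) = subst-s ok (soundB ⊢c)

sound◇ : ∀ {P Q c} → ⊢◇B P c Q → Valid Φ◇ P c Q
sound◇ (d-skip {P} P⪯𝟘) = skip-s (Admits◇ P P⪯𝟘)
sound◇ (d-assign {P} P⪯𝟘 post) = assign-s (Admits◇ P P⪯𝟘) post
sound◇ (d-assume {P} P⪯𝟘) = assume-s (Admits◇ P P⪯𝟘)
sound◇ (d-star {P} P⪯𝟘) = star0-s (Admits◇ P P⪯𝟘)
sound◇ (d-tick {e = e} dips) =
  tick-s λ σ p≤P → fin≤∞-trans⁻ (≤∞-min∞ p≤P (≤∞-⊖∞ (⟦ e ⟧ₑ σ) p≤P)) (dips σ)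
sound◇ (d-seqL ⊢c ⊢d) = seq-s Φ◇-combinesˡ (sound◇ ⊢c) (soundB ⊢d)
sound◇ (d-seqR ⊢c ⊢d) = seq-s Φ◇-combinesʳ (soundB ⊢c) (sound◇ ⊢d)
sound◇ (d-choiceˡ ⊢c) = Valid-map e-choiceˡ (sound◇ ⊢c)
sound◇ (d-choiceʳ ⊢d) = Valid-map e-choiceʳ (sound◇ ⊢d)
sound◇ (d-loop P k steps (m , m<k , dip)) =
  loop◇-s P k m m<k (λ n n<k → soundB (steps n n<k)) (sound◇ dip)
sound◇ (d-local ⊢c supP supQ) = local-s supP supQ (sound◇ ⊢c)
sound◇ (d-disj Ps Qs ⊢cs supP supQ) = disj-s Ps Qs supP supQ λ i → sound◇ (⊢cs i)
sound◇ (d-const {b = b} ⊢c disj) = const-s b disj (sound◇ ⊢c)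
sound◇ (d-relax ⊢c indep F⪯𝟘) =
  relax-s (λ σ k≤F l≤0 → ℤ.+-mono-≤ l≤0 (fin≤∞-trans⁻ k≤F (F⪯𝟘 σ))) indep (sound◇ ⊢c)
sound◇ (d-conseq P⪯P' ⊢c Q'⪯Q) = conseq-s P⪯P' (sound◇ ⊢c) Q'⪯Q
sound◇ (d-subst ⊢c ok) = subst-s ok (sound◇ ⊢c)

theorem3 : ∀ (P Q : RF) (C : Cmd) → ⊢◇B P C Q → ⊨◇B P C Q
theorem3 P Q C ⊢◇ = sound◇ ⊢◇ .run
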